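{- Let $m\ge 3$ and suppose $x_{i,j}$ is a non-negative integer for each $i\in[3]$ and $j\in[m^2]$. For each $i\in[3]$, suppose $n_i=x_{i,1}=\cdots=x_{i,m}\le x_{i,m+1}=\cdots=x_{i,m(m-1)}\le x_{i,m(m-1)+1}=\cdots=x_{i,m^2}=n_i+1$ for some $n_i\ge 0$, and $n_1\le n_2$, $n_1\le n_3$. Let $\mathbf{x}_i=(x_{i,1},\ldots,x_{i,m^2})$. For each $i\in[3]$, if $\mathbf{x}_i$ is odd let $s_i=n_i$ and $o_i=n_i+1$, and if $\mathbf{x}_i$ is even let $s_i=n_i+1$ and $o_i=n_i$. Let $h_1$ be a permutation of $[m^2]$ with $x_{1,h_1(j)}=s_1$ for $j\in[m]$ and $x_{1,h_1(j)}=o_1$ otherwise. Define permutations $h_2,h_3$ of $[m^2]$ as follows. (i) If the parity of $\mathbf{x}_1$ differs from both $\mathbf{x}_2$ and $\mathbf{x}_3$: for each $i\in\{2,3\}$, $h_i$ is a permutation with $x_{i,h_i(j)}=s_i$ for $j\in[m]$ and $x_{i,h_i(j)}=o_i$ otherwise. (ii) If the parity of $\mathbf{x}_1$ differs from $\mathbf{x}_2$ and equals that of $\mathbf{x}_3$: $h_2$ is a permutation with $x_{2,h_2(j)}=s_2$ for $j\in[m]$ and $=o_2$ otherwise, and $h_3$ is a permutation with $x_{3,h_3(j)}=s_3$ for $j\in[2m]-[m]$ and $=o_3$ otherwise. (iii) If $\mathbf{x}_1,\mathbf{x}_2,\mathbf{x}_3$ all have the same parity: $h_2$ is a permutation with $x_{2,h_2(j)}=s_2$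 for $j\in[2m]-[m]$ and $=o_2$ otherwise, and $h_3$ is a permutation with $x_{3,h_3(j)}=s_3$ for $j\in[3m]-[2m]$ and $=o_3$ otherwise. Let $N=|\{j\in[m^2]:x_{1,j}=n_1\}|$, $f(j)=m^2+1-j$, and $g(j)=m^2+j-N$ for $j\in[N]$, $g(j)=j-N$ otherwise. Then $$\sum_{j=1}^{m^2}x_{1,h_1(j)}x_{2,h_2(j)}x_{3,h_3(j)}=\sum_{j=1}^{m^2}x_{1,j}x_{2,f(j)}x_{3,g(j)},$$ and in particular, for any permutations $\sigma_1,\sigma_2$ of $[m^2]$, $$\sum_{j=1}^{m^2}x_{1,h_1(j)}x_{2,h_2(j)}x_{3,h_3(j)}\le\sum_{j=1}^{m^2}x_{1,j}x_{2,\sigma_1(j)}x_{3,\sigma_2(j)}.$$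
   Context: $[k]=\{1,\ldots,k\}$. A vector $\mathbf{x}=(x_1,\ldots,x_{m^2})$ satisfying $n=x_1=\cdots=x_m\le x_{m+1}=\cdots=x_{m(m-1)}\le x_{m(m-1)+1}=\cdots=x_{m^2}=n+1$ for some $n\ge0$ is called odd if exactly $m$ of its coordinates equal $n$, and even if exactly $m$ of its coordinates equal $n+1$; this is its parity. -}

module Defs where

open import Data.Nat using (ℕ; zero; suc; _+_; _*_; _∸_; _≤_; _<_; _<?_; _≤?_; z≤n)
open import Data.Nat.Properties
open import Data.Fin using (Fin; toℕ; fromℕ<)
import Data.Fin as Fin
open import Data.Fin.Properties using (toℕ<n)
open import Data.Fin.Permutation using (Permutation′; _⟨$⟩ʳ_)
open import Data.Product using (Σ; _×_; _,_)
open import Data.Sum using (_⊎_)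
open import Relation.Nullary using (yes; no)
open import Relation.Nullary.Decidable using (⌊_⌋)
open import Relation.Binary.PropositionalEquality using (_≡_; subst; sym)

-- Indices: coordinate j ∈ [k] (1-based) is represented by t : Fin k with j = toℕ t + 1.

∑ : ∀ {k} → (Fin k → ℕ) → ℕ
∑ {zero}  v = 0
∑ {suc k} v = v Fin.zero + ∑ (λ t → v (Fin.suc t))

count : ∀ {k} → (Fin k → ℕ) → ℕ → ℕ
count v a = ∑ (λ t → indicator (v t Data.Nat.≟ a))
  where
  open import Relation.Nullary using (Dec)
  indicator : ∀ {P : Set} → Dec P → ℕ
  indicator (yes _) = 1
  indicator (no _)  = 0

Shape : (m : ℕ) → (Fin (m * m) → ℕ) → ℕ → Set
Shape m x n =
  Σ ℕ λ c → n ≤ c × c ≤ suc n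
    × (∀ t → toℕ t < m → x t ≡ n)
    × (∀ t → m ≤ toℕ t → toℕ t < m * (m ∸ 1) → x t ≡ c)
    × (∀ t → m * (m ∸ 1) ≤ toℕ t → x t ≡ suc n)

data Parity : Set where
  odd even : Parity

HasParity : (m : ℕ) → (Fin (m * m) → ℕ) → ℕ → Parity → Set
HasParity m x n odd  = count x n ≡ m
HasParity m x n even = count x (suc n) ≡ m

sVal oVal : Parity → ℕ → ℕ
sVal odd  n = n
sVal even n = suc n
oVal odd  n = suc n
oVal even n = n

-- h places value s at (1-based) positions j with lo < j ≤ hi, i.e. j ∈ [hi] - [lo],
-- and value o at every other position.
Places : ∀ {k} → (Fin k → ℕ) → Permutation′ k → ℕ → ℕ → ℕ → ℕ → Set
Places x h s o lo hi =
  ∀ t → (lo ≤ toℕ t → toℕ t < hi → x (h ⟨$⟩ʳ t) ≡ s)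
      × ((toℕ t < lo ⊎ hi ≤ toℕ t) → x (h ⟨$⟩ʳ t) ≡ o)

-- g(j) = K + j - N for j ∈ [N], g(j) = j - N otherwise (1-based), here K = m².
-- 0-based: t ↦ K + t - N if t < N, else t - N.
gℕ : ℕ → ℕ → ℕ → ℕ
gℕ K N t with t <? N
... | yes _ = K + t ∸ N
... | no _  = t ∸ N

gℕ< : ∀ K N t → t < K → gℕ K N t < K
gℕ< K N t t<K with t <? N
... | yes t<N with N ≤? K + t
...   | yes N≤ = subst (K + t ∸ N <_) (m+n∸n≡m K N)
                   (∸-monoˡ-< (+-monoʳ-< K t<N) N≤)
...   | no N≰ = subst (_< K) (sym (m≤n⇒m∸n≡0 (<⇒≤ (≰⇒> N≰)))) (≤-<-trans z≤n t<K)
gℕ< K N t t<K | no _ = ≤-<-trans (m∸n≤m t N) t<K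

gShift : ∀ {K} → ℕ → Fin K → Fin K
gShift {K} N t = fromℕ< (gℕ< K N (toℕ t) (toℕ<n t))

{-# OPTIONS --safe #-}
-- Each xᵢ takes only the values nᵢ and nᵢ + 1, so every summand is the value of
-- a b c at a corner of the box {n₁, n₁ + 1} × {n₂, n₂ + 1} × {n₃, n₃ + 1}.  A facet
-- of the lower convex envelope of a b c on this box gives a separable bound
-- a b c + k ≥ ℓ₁ a + ℓ₂ b + ℓ₃ c, with equality exactly at the four corners of the
-- facet.  Summed over all positions the right-hand side no longer depends on the
-- arrangement, so every arrangement that only uses the corners of one facet has the
-- least possible sum.  In each parity case one facet is tight both for (h₁, h₂, h₃)
-- and for (id, f, g).

module Submission where

open import Defs
open import Data.Nat using (ℕ; zero; suc; _+_; _*_; _∸_; _≤_; _<_; _<?_; _≟_; _<ᵇ_; z≤n; s≤s)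
open import Data.Nat.Properties
open import Algebra.Properties.CommutativeMonoid.Sum +-0-commutativeMonoid
  using (sum; sum-cong-≗; ∑-distrib-+; sum-permute)
open import Data.Fin using (Fin; toℕ; opposite)
import Data.Fin as Fin
open import Data.Fin.Properties using (toℕ<n; toℕ-fromℕ<; toℕ-injective; opposite-prop)
open import Data.Fin.Permutation using (Permutation′; _⟨$⟩ʳ_; permutation)
import Data.Fin.Permutation as Perm
open import Data.Product using (_×_; _,_; proj₁; proj₂)
open import Data.Sum using (_⊎_; inj₁; inj₂; [_,_]′)
import Data.Sum as Sum
open import Data.Bool using (Bool; true; false; not; _∧_; if_then_else_)
open import Data.Bool.Properties using (not-involutive)
open import Data.Nat.Tactic.RingSolver using (solve-∀)
open import Function using (_∘_)
open import Relation.Nullary using (yes; no)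
open import Relation.Nullary.Reflects using (Reflects; ofʸ; ofⁿ)
open import Relation.Nullary.Negation using (contradiction)
open import Relation.Binary.PropositionalEquality

∑≡sum : ∀ {k} (f : Fin k → ℕ) → ∑ f ≡ sum f
∑≡sum {zero}  f = refl
∑≡sum {suc k} f = cong (f Fin.zero +_) (∑≡sum (f ∘ Fin.suc))

∑-cong : ∀ {k} {f g : Fin k → ℕ} → f ≗ g → ∑ f ≡ ∑ g
∑-cong {f = f} {g} f≗g = trans (∑≡sum f) (trans (sum-cong-≗ f≗g) (sym (∑≡sum g)))

∑-+ : ∀ {k} (f g : Fin k → ℕ) → ∑ (λ t → f t + g t) ≡ ∑ f + ∑ g
∑-+ f g = trans (∑≡sum (λ t → f t + g t)) (trans (∑-distrib-+ f g) (sym (cong₂ _+_ (∑≡sum f) (∑≡sum g))))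

∑-permute : ∀ {k} (f : Fin k → ℕ) (π : Permutation′ k) → ∑ (f ∘ (π ⟨$⟩ʳ_)) ≡ ∑ f
∑-permute f π = trans (∑≡sum (f ∘ (π ⟨$⟩ʳ_))) (trans (sym (sum-permute f π)) (sym (∑≡sum f)))

∑-mono-≤ : ∀ {k} {f g : Fin k → ℕ} → (∀ t → f t ≤ g t) → ∑ f ≤ ∑ g
∑-mono-≤ {zero}  f≤g = z≤n
∑-mono-≤ {suc k} f≤g = +-mono-≤ (f≤g Fin.zero) (∑-mono-≤ (f≤g ∘ Fin.suc))

∑-zero : ∀ k → ∑ {k} (λ _ → 0) ≡ 0
∑-zero zero    = refl
∑-zero (suc k) = ∑-zero k

∑-separable-permute : ∀ {k} (f g h : Fin k → ℕ) (π ρ σ : Permutation′ k) →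
  ∑ (λ t → f (π ⟨$⟩ʳ t) + g (ρ ⟨$⟩ʳ t) + h (σ ⟨$⟩ʳ t)) ≡ ∑ f + ∑ g + ∑ h
∑-separable-permute f g h π ρ σ = begin
  ∑ (λ t → f (π ⟨$⟩ʳ t) + g (ρ ⟨$⟩ʳ t) + h (σ ⟨$⟩ʳ t))
    ≡⟨ ∑-+ (λ t → f (π ⟨$⟩ʳ t) + g (ρ ⟨$⟩ʳ t)) (h ∘ (σ ⟨$⟩ʳ_)) ⟩
  ∑ (λ t → f (π ⟨$⟩ʳ t) + g (ρ ⟨$⟩ʳ t)) + ∑ (h ∘ (σ ⟨$⟩ʳ_))
    ≡⟨ cong (_+ ∑ (h ∘ (σ ⟨$⟩ʳ_))) (∑-+ (f ∘ (π ⟨$⟩ʳ_)) (g ∘ (ρ ⟨$⟩ʳ_))) ⟩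
  ∑ (f ∘ (π ⟨$⟩ʳ_)) + ∑ (g ∘ (ρ ⟨$⟩ʳ_)) + ∑ (h ∘ (σ ⟨$⟩ʳ_))
    ≡⟨ cong₂ _+_ (cong₂ _+_ (∑-permute f π) (∑-permute g ρ)) (∑-permute h σ) ⟩
  ∑ f + ∑ g + ∑ h ∎
  where open ≡-Reasoning

gℕ-low : ∀ K N t → t < N → gℕ K N t ≡ K + t ∸ N
gℕ-low K N t t<N with t <? N
... | yes _   = refl
... | no t≮N = contradiction t<N t≮N

gℕ-high : ∀ K N t → N ≤ t → gℕ K N t ≡ t ∸ N
gℕ-high K N t N≤t with t <? N
... | yes t<N = contradiction N≤t (<⇒≱ t<N)
... | no _    = refl

gℕ-inverse : ∀ {K N t} → N ≤ K → t < K → gℕ K (K ∸ N) (gℕ K N t) ≡ t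
gℕ-inverse {K} {N} {t} N≤K t<K with t <? N
... | yes t<N = begin
  gℕ K (K ∸ N) (K + t ∸ N) ≡⟨ cong (gℕ K (K ∸ N)) K+t∸N ⟩
  gℕ K (K ∸ N) (K ∸ N + t) ≡⟨ gℕ-high K (K ∸ N) _ (m≤m+n (K ∸ N) t) ⟩
  K ∸ N + t ∸ (K ∸ N)      ≡⟨ m+n∸m≡n (K ∸ N) t ⟩
  t                        ∎
  where
  open ≡-Reasoning
  K+t∸N : K + t ∸ N ≡ K ∸ N + t
  K+t∸N = +-∸-comm t N≤K
... | no t≮N = begin
  gℕ K (K ∸ N) (t ∸ N) ≡⟨ gℕ-low K (K ∸ N) (t ∸ N) (∸-monoˡ-< t<K N≤t) ⟩
  K + (t ∸ N) ∸ (K ∸ N)  ≡⟨ cong (_∸ (K ∸ N)) K+[t∸N] ⟩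
  K ∸ N + t ∸ (K ∸ N)    ≡⟨ m+n∸m≡n (K ∸ N) t ⟩
  t                      ∎
  where
  open ≡-Reasoning
  N≤t : N ≤ t
  N≤t = ≮⇒≥ t≮N
  K+[t∸N] : K + (t ∸ N) ≡ K ∸ N + t
  K+[t∸N] = begin
    K + (t ∸ N)           ≡⟨ cong (_+ (t ∸ N)) (m∸n+n≡m N≤K) ⟨
    K ∸ N + N + (t ∸ N)   ≡⟨ +-assoc (K ∸ N) N (t ∸ N) ⟩
    K ∸ N + (N + (t ∸ N)) ≡⟨ cong (K ∸ N +_) (m+[n∸m]≡n N≤t) ⟩
    K ∸ N + t             ∎

gShift-inverse : ∀ {K N} → N ≤ K → (t : Fin K) → gShift (K ∸ N) (gShift N t) ≡ t
gShift-inverse {K} {N} N≤K t = toℕ-injective (begin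
  toℕ (gShift (K ∸ N) (gShift N t))    ≡⟨ toℕ-fromℕ< _ ⟩
  gℕ K (K ∸ N) (toℕ (gShift N t))     ≡⟨ cong (gℕ K (K ∸ N)) (toℕ-fromℕ< _) ⟩
  gℕ K (K ∸ N) (gℕ K N (toℕ t))       ≡⟨ gℕ-inverse N≤K (toℕ<n t) ⟩
  toℕ t                               ∎)
  where open ≡-Reasoning

rotation : ∀ {K} N → N ≤ K → Permutation′ K
rotation {K} N N≤K = permutation (gShift N) (gShift (K ∸ N)) inverseˡ (gShift-inverse N≤K)
  where
  inverseˡ : ∀ u → gShift N (gShift (K ∸ N) u) ≡ u
  inverseˡ u = subst (λ M → gShift M (gShift (K ∸ N) u) ≡ u) (m∸[m∸n]≡n N≤K)
                 (gShift-inverse (m∸n≤m K N) u)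

level : ℕ → Bool → ℕ
level n false = n
level n true  = suc n

bit : Bool → ℕ
bit false = 0
bit true  = 1

level≡+bit : ∀ n b → level n b ≡ n + bit b
level≡+bit n false = sym (+-identityʳ n)
level≡+bit n true  = +-comm 1 n

level∸ : ∀ n b → level n b ∸ n ≡ bit b
level∸ n b = trans (cong (_∸ n) (level≡+bit n b)) (m+n∸m≡n n (bit b))

record Linear : Set where
  constructor ⟨_,_,_,_⟩
  field c₀ c₁ c₂ c₃ : ℕ

open Linear

⟦_⟧ : Linear → ℕ → ℕ → ℕ → ℕ
⟦ L ⟧ n₁ d₂ d₃ = c₀ L + c₁ L * n₁ + c₂ L * d₂ + c₃ L * d₃

-- Facets of the lower convex envelope of a b c on the box with corners
-- (level n₁ b₁, level (n₁ + d₂) b₂, level (n₁ + d₃) b₃), named after the four corners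
-- b₁b₂b₃ where they have zero slack: oneHigh at 000 100 010 001, oneLow at
-- 011 101 110 111, firstApart at 100 010 001 011, firstThirdApart at 100 101 001 011.
data Facet : Set where
  oneHigh oneLow firstApart firstThirdApart : Facet

offset : Facet → Linear
offset oneHigh         = ⟨ 0 , 0 , 0 , 0 ⟩
offset oneLow          = ⟨ 2 , 3 , 1 , 1 ⟩
offset firstApart      = ⟨ 0 , 1 , 0 , 0 ⟩
offset firstThirdApart = ⟨ 0 , 1 , 1 , 0 ⟩

correction₁ correction₂ correction₃ : Facet → Linear
correction₁ oneHigh         = ⟨ 0 , 0 , 0 , 0 ⟩
correction₁ oneLow          = ⟨ 1 , 2 , 1 , 1 ⟩
correction₁ firstApart      = ⟨ 0 , 1 , 0 , 0 ⟩
correction₁ firstThirdApart = ⟨ 0 , 1 , 1 , 0 ⟩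
correction₂ oneHigh         = ⟨ 0 , 0 , 0 , 0 ⟩
correction₂ oneLow          = ⟨ 1 , 2 , 0 , 1 ⟩
correction₂ firstApart      = ⟨ 0 , 1 , 0 , 0 ⟩
correction₂ firstThirdApart = ⟨ 0 , 1 , 0 , 0 ⟩
correction₃ oneHigh         = ⟨ 0 , 0 , 0 , 0 ⟩
correction₃ oneLow          = ⟨ 1 , 2 , 1 , 0 ⟩
correction₃ firstApart      = ⟨ 0 , 1 , 0 , 0 ⟩
correction₃ firstThirdApart = ⟨ 0 , 1 , 1 , 0 ⟩

weight₁ weight₂ weight₃ : Facet → ℕ → ℕ → ℕ → ℕ
weight₁ F n₁ d₂ d₃ = (n₁ + d₂) * (n₁ + d₃) + ⟦ correction₁ F ⟧ n₁ d₂ d₃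
weight₂ F n₁ d₂ d₃ = n₁ * (n₁ + d₃) + ⟦ correction₂ F ⟧ n₁ d₂ d₃
weight₃ F n₁ d₂ d₃ = n₁ * (n₁ + d₂) + ⟦ correction₃ F ⟧ n₁ d₂ d₃

slack : Facet → Bool → Bool → Bool → Linear
slack oneHigh         false false false = ⟨ 0 , 0 , 0 , 0 ⟩
slack oneHigh         false false true  = ⟨ 0 , 0 , 0 , 0 ⟩
slack oneHigh         false true  false = ⟨ 0 , 0 , 0 , 0 ⟩
slack oneHigh         false true  true  = ⟨ 0 , 1 , 0 , 0 ⟩
slack oneHigh         true  false false = ⟨ 0 , 0 , 0 , 0 ⟩
slack oneHigh         true  false true  = ⟨ 0 , 1 , 1 , 0 ⟩
slack oneHigh         true  true  false = ⟨ 0 , 1 , 0 , 1 ⟩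
slack oneHigh         true  true  true  = ⟨ 1 , 3 , 1 , 1 ⟩
slack oneLow          false false false = ⟨ 2 , 3 , 1 , 1 ⟩
slack oneLow          false false true  = ⟨ 1 , 1 , 0 , 1 ⟩
slack oneLow          false true  false = ⟨ 1 , 1 , 1 , 0 ⟩
slack oneLow          false true  true  = ⟨ 0 , 0 , 0 , 0 ⟩
slack oneLow          true  false false = ⟨ 1 , 1 , 0 , 0 ⟩
slack oneLow          true  false true  = ⟨ 0 , 0 , 0 , 0 ⟩
slack oneLow          true  true  false = ⟨ 0 , 0 , 0 , 0 ⟩
slack oneLow          true  true  true  = ⟨ 0 , 0 , 0 , 0 ⟩
slack firstApart      false false false = ⟨ 0 , 1 , 0 , 0 ⟩
slack firstApart      false false true  = ⟨ 0 , 0 , 0 , 0 ⟩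
slack firstApart      false true  false = ⟨ 0 , 0 , 0 , 0 ⟩
slack firstApart      false true  true  = ⟨ 0 , 0 , 0 , 0 ⟩
slack firstApart      true  false false = ⟨ 0 , 0 , 0 , 0 ⟩
slack firstApart      true  false true  = ⟨ 0 , 0 , 1 , 0 ⟩
slack firstApart      true  true  false = ⟨ 0 , 0 , 0 , 1 ⟩
slack firstApart      true  true  true  = ⟨ 1 , 1 , 1 , 1 ⟩
slack firstThirdApart false false false = ⟨ 0 , 1 , 1 , 0 ⟩
slack firstThirdApart false false true  = ⟨ 0 , 0 , 0 , 0 ⟩
slack firstThirdApart false true  false = ⟨ 0 , 0 , 1 , 0 ⟩
slack firstThirdApart false true  true  = ⟨ 0 , 0 , 0 , 0 ⟩
slack firstThirdApart true  false false = ⟨ 0 , 0 , 0 , 0 ⟩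
slack firstThirdApart true  false true  = ⟨ 0 , 0 , 0 , 0 ⟩
slack firstThirdApart true  true  false = ⟨ 0 , 0 , 0 , 1 ⟩
slack firstThirdApart true  true  true  = ⟨ 1 , 1 , 0 , 1 ⟩

Tight : Facet → Bool → Bool → Bool → Set
Tight F b₁ b₂ b₃ = slack F b₁ b₂ b₃ ≡ ⟨ 0 , 0 , 0 , 0 ⟩

-- Stated with ⟦_⟧ unfolded and level n b written n + bit b: the ring solver does not
-- unfold definitions, so the only non-polynomial subterms it may meet are table entries.
facet-decomposition : ∀ F b₁ b₂ b₃ n₁ d₂ d₃ →
  (n₁ + bit b₁) * (n₁ + d₂ + bit b₂) * (n₁ + d₃ + bit b₃)
    + (c₀ (offset F) + c₁ (offset F) * n₁ + c₂ (offset F) * d₂ + c₃ (offset F) * d₃)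
  ≡ n₁ * (n₁ + d₂) * (n₁ + d₃)
    + ((n₁ + d₂) * (n₁ + d₃)
        + (c₀ (correction₁ F) + c₁ (correction₁ F) * n₁ + c₂ (correction₁ F) * d₂ + c₃ (correction₁ F) * d₃))
      * bit b₁
    + (n₁ * (n₁ + d₃)
        + (c₀ (correction₂ F) + c₁ (correction₂ F) * n₁ + c₂ (correction₂ F) * d₂ + c₃ (correction₂ F) * d₃))
      * bit b₂
    + (n₁ * (n₁ + d₂)
        + (c₀ (correction₃ F) + c₁ (correction₃ F) * n₁ + c₂ (correction₃ F) * d₂ + c₃ (correction₃ F) * d₃))
      * bit b₃
    + (c₀ (slack F b₁ b₂ b₃) + c₁ (slack F b₁ b₂ b₃) * n₁
        + c₂ (slack F b₁ b₂ b₃) * d₂ + c₃ (slack F b₁ b₂ b₃) * d₃)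
facet-decomposition oneHigh         false false false = solve-∀
facet-decomposition oneHigh         false false true  = solve-∀
facet-decomposition oneHigh         false true  false = solve-∀
facet-decomposition oneHigh         false true  true  = solve-∀
facet-decomposition oneHigh         true  false false = solve-∀
facet-decomposition oneHigh         true  false true  = solve-∀
facet-decomposition oneHigh         true  true  false = solve-∀
facet-decomposition oneHigh         true  true  true  = solve-∀
facet-decomposition oneLow          false false false = solve-∀
facet-decomposition oneLow          false false true  = solve-∀
facet-decomposition oneLow          false true  false = solve-∀
facet-decomposition oneLow          false true  true  = solve-∀
facet-decomposition oneLow          true  false false = solve-∀
facet-decomposition oneLow          true  false true  = solve-∀
facet-decomposition oneLow          true  true  false = solve-∀
facet-decomposition oneLow          true  true  true  = solve-∀
facet-decomposition firstApart      false false false = solve-∀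
facet-decomposition firstApart      false false true  = solve-∀
facet-decomposition firstApart      false true  false = solve-∀
facet-decomposition firstApart      false true  true  = solve-∀
facet-decomposition firstApart      true  false false = solve-∀
facet-decomposition firstApart      true  false true  = solve-∀
facet-decomposition firstApart      true  true  false = solve-∀
facet-decomposition firstApart      true  true  true  = solve-∀
facet-decomposition firstThirdApart false false false = solve-∀
facet-decomposition firstThirdApart false false true  = solve-∀
facet-decomposition firstThirdApart false true  false = solve-∀
facet-decomposition firstThirdApart false true  true  = solve-∀
facet-decomposition firstThirdApart true  false false = solve-∀
facet-decomposition firstThirdApart true  false true  = solve-∀
facet-decomposition firstThirdApart true  true  false = solve-∀
facet-decomposition firstThirdApart true  true  true  = solve-∀

arrangementSum : ∀ {K} (x₁ x₂ x₃ : Fin K → ℕ) (π₁ π₂ π₃ : Permutation′ K) → ℕ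
arrangementSum x₁ x₂ x₃ π₁ π₂ π₃ = ∑ (λ t → x₁ (π₁ ⟨$⟩ʳ t) * x₂ (π₂ ⟨$⟩ʳ t) * x₃ (π₃ ⟨$⟩ʳ t))

read-everywhere : ∀ {K n} {x : Fin K → ℕ} (π : Permutation′ K) (β : Fin K → Bool) →
  (∀ t → x (π ⟨$⟩ʳ t) ≡ level n (β t)) → ∀ u → x u ≡ level n (β (π Perm.⟨$⟩ˡ u))
read-everywhere {x = x} π β reads u = trans (cong x (sym (Perm.inverseʳ π))) (reads (π Perm.⟨$⟩ˡ u))

module Minorant (F : Facet) (n₁ d₂ d₃ : ℕ) where

  n₂ n₃ k : ℕ
  n₂ = n₁ + d₂
  n₃ = n₁ + d₃
  k = ⟦ offset F ⟧ n₁ d₂ d₃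

  ℓ₁ ℓ₂ ℓ₃ : ℕ → ℕ
  ℓ₁ a = n₁ * n₂ * n₃ + weight₁ F n₁ d₂ d₃ * (a ∸ n₁)
  ℓ₂ b = weight₂ F n₁ d₂ d₃ * (b ∸ n₂)
  ℓ₃ c = weight₃ F n₁ d₂ d₃ * (c ∸ n₃)

  product≡minorant+slack : ∀ b₁ b₂ b₃ →
    level n₁ b₁ * level n₂ b₂ * level n₃ b₃ + k
      ≡ ℓ₁ (level n₁ b₁) + ℓ₂ (level n₂ b₂) + ℓ₃ (level n₃ b₃) + ⟦ slack F b₁ b₂ b₃ ⟧ n₁ d₂ d₃
  product≡minorant+slack b₁ b₂ b₃
    rewrite level∸ n₁ b₁ | level∸ n₂ b₂ | level∸ n₃ b₃
          | level≡+bit n₁ b₁ | level≡+bit n₂ b₂ | level≡+bit n₃ b₃ = facet-decomposition F b₁ b₂ b₃ n₁ d₂ d₃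

  minorant-≤ : ∀ {a b c} b₁ b₂ b₃ → a ≡ level n₁ b₁ → b ≡ level n₂ b₂ → c ≡ level n₃ b₃ →
    ℓ₁ a + ℓ₂ b + ℓ₃ c ≤ a * b * c + k
  minorant-≤ b₁ b₂ b₃ refl refl refl =
    ≤-trans (m≤m+n _ (⟦ slack F b₁ b₂ b₃ ⟧ n₁ d₂ d₃)) (≤-reflexive (sym (product≡minorant+slack b₁ b₂ b₃)))

  minorant-tight : ∀ {a b c} b₁ b₂ b₃ → a ≡ level n₁ b₁ → b ≡ level n₂ b₂ → c ≡ level n₃ b₃ →
    Tight F b₁ b₂ b₃ → a * b * c + k ≡ ℓ₁ a + ℓ₂ b + ℓ₃ c
  minorant-tight b₁ b₂ b₃ refl refl refl tight =
    trans (product≡minorant+slack b₁ b₂ b₃)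
          (trans (cong (λ L → minorant + ⟦ L ⟧ n₁ d₂ d₃) tight) (+-identityʳ minorant))
    where minorant = ℓ₁ (level n₁ b₁) + ℓ₂ (level n₂ b₂) + ℓ₃ (level n₃ b₃)

  module _ {K} (x₁ x₂ x₃ : Fin K → ℕ) where

    record TightArrangement (π₁ π₂ π₃ : Permutation′ K) : Set where
      field
        β₁ β₂ β₃ : Fin K → Bool
        reads₁ : ∀ t → x₁ (π₁ ⟨$⟩ʳ t) ≡ level n₁ (β₁ t)
        reads₂ : ∀ t → x₂ (π₂ ⟨$⟩ʳ t) ≡ level n₂ (β₂ t)
        reads₃ : ∀ t → x₃ (π₃ ⟨$⟩ʳ t) ≡ level n₃ (β₃ t)
        tight  : ∀ t → Tight F (β₁ t) (β₂ t) (β₃ t)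

    offsets baseline : ℕ
    offsets  = ∑ {K} (λ _ → k)
    baseline = ∑ (ℓ₁ ∘ x₁) + ∑ (ℓ₂ ∘ x₂) + ∑ (ℓ₃ ∘ x₃)

    arrangementSum+offsets : ∀ π₁ π₂ π₃ →
      arrangementSum x₁ x₂ x₃ π₁ π₂ π₃ + offsets
        ≡ ∑ (λ t → x₁ (π₁ ⟨$⟩ʳ t) * x₂ (π₂ ⟨$⟩ʳ t) * x₃ (π₃ ⟨$⟩ʳ t) + k)
    arrangementSum+offsets π₁ π₂ π₃ =
      sym (∑-+ (λ t → x₁ (π₁ ⟨$⟩ʳ t) * x₂ (π₂ ⟨$⟩ʳ t) * x₃ (π₃ ⟨$⟩ʳ t)) (λ _ → k))

    tight-sum : ∀ {π₁ π₂ π₃} → TightArrangement π₁ π₂ π₃ →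
      arrangementSum x₁ x₂ x₃ π₁ π₂ π₃ + offsets ≡ baseline
    tight-sum {π₁} {π₂} {π₃} T = begin
      arrangementSum x₁ x₂ x₃ π₁ π₂ π₃ + offsets
        ≡⟨ arrangementSum+offsets π₁ π₂ π₃ ⟩
      ∑ (λ t → x₁ (π₁ ⟨$⟩ʳ t) * x₂ (π₂ ⟨$⟩ʳ t) * x₃ (π₃ ⟨$⟩ʳ t) + k)
        ≡⟨ ∑-cong pointwise ⟩
      ∑ (λ t → ℓ₁ (x₁ (π₁ ⟨$⟩ʳ t)) + ℓ₂ (x₂ (π₂ ⟨$⟩ʳ t)) + ℓ₃ (x₃ (π₃ ⟨$⟩ʳ t)))
        ≡⟨ ∑-separable-permute (ℓ₁ ∘ x₁) (ℓ₂ ∘ x₂) (ℓ₃ ∘ x₃) π₁ π₂ π₃ ⟩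
      baseline ∎
      where
      open ≡-Reasoning
      open TightArrangement T
      pointwise : ∀ t → x₁ (π₁ ⟨$⟩ʳ t) * x₂ (π₂ ⟨$⟩ʳ t) * x₃ (π₃ ⟨$⟩ʳ t) + k
                          ≡ ℓ₁ (x₁ (π₁ ⟨$⟩ʳ t)) + ℓ₂ (x₂ (π₂ ⟨$⟩ʳ t)) + ℓ₃ (x₃ (π₃ ⟨$⟩ʳ t))
      pointwise t = minorant-tight (β₁ t) (β₂ t) (β₃ t) (reads₁ t) (reads₂ t) (reads₃ t) (tight t)

    -- Any tight arrangement shows that each xᵢ only takes its two levels.
    baseline-≤ : ∀ {ρ₁ ρ₂ ρ₃} → TightArrangement ρ₁ ρ₂ ρ₃ → ∀ π₁ π₂ π₃ →
      baseline ≤ arrangementSum x₁ x₂ x₃ π₁ π₂ π₃ + offsets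
    baseline-≤ {ρ₁} {ρ₂} {ρ₃} T π₁ π₂ π₃ = begin
      baseline
        ≡⟨ ∑-separable-permute (ℓ₁ ∘ x₁) (ℓ₂ ∘ x₂) (ℓ₃ ∘ x₃) π₁ π₂ π₃ ⟨
      ∑ (λ t → ℓ₁ (x₁ (π₁ ⟨$⟩ʳ t)) + ℓ₂ (x₂ (π₂ ⟨$⟩ʳ t)) + ℓ₃ (x₃ (π₃ ⟨$⟩ʳ t)))
        ≤⟨ ∑-mono-≤ pointwise ⟩
      ∑ (λ t → x₁ (π₁ ⟨$⟩ʳ t) * x₂ (π₂ ⟨$⟩ʳ t) * x₃ (π₃ ⟨$⟩ʳ t) + k)
        ≡⟨ arrangementSum+offsets π₁ π₂ π₃ ⟨
      arrangementSum x₁ x₂ x₃ π₁ π₂ π₃ + offsets ∎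
      where
      open ≤-Reasoning
      open TightArrangement T
      pointwise : ∀ t → ℓ₁ (x₁ (π₁ ⟨$⟩ʳ t)) + ℓ₂ (x₂ (π₂ ⟨$⟩ʳ t)) + ℓ₃ (x₃ (π₃ ⟨$⟩ʳ t))
                          ≤ x₁ (π₁ ⟨$⟩ʳ t) * x₂ (π₂ ⟨$⟩ʳ t) * x₃ (π₃ ⟨$⟩ʳ t) + k
      pointwise t = minorant-≤ _ _ _ (read-everywhere {x = x₁} ρ₁ β₁ reads₁ (π₁ ⟨$⟩ʳ t))
                                     (read-everywhere {x = x₂} ρ₂ β₂ reads₂ (π₂ ⟨$⟩ʳ t))
                                     (read-everywhere {x = x₃} ρ₃ β₃ reads₃ (π₃ ⟨$⟩ʳ t))

    tight-arrangements-minimal : ∀ {π₁ π₂ π₃ ρ₁ ρ₂ ρ₃} →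
      TightArrangement π₁ π₂ π₃ → TightArrangement ρ₁ ρ₂ ρ₃ →
      (arrangementSum x₁ x₂ x₃ π₁ π₂ π₃ ≡ arrangementSum x₁ x₂ x₃ ρ₁ ρ₂ ρ₃)
      × (∀ σ₁ σ₂ σ₃ → arrangementSum x₁ x₂ x₃ π₁ π₂ π₃ ≤ arrangementSum x₁ x₂ x₃ σ₁ σ₂ σ₃)
    tight-arrangements-minimal Tπ Tρ =
        +-cancelʳ-≡ _ _ _ (trans (tight-sum Tπ) (sym (tight-sum Tρ)))
      , λ σ₁ σ₂ σ₃ → +-cancelʳ-≤ offsets _ _
                       (subst (_≤ arrangementSum x₁ x₂ x₃ σ₁ σ₂ σ₃ + offsets) (sym (tight-sum Tπ))
                              (baseline-≤ Tπ σ₁ σ₂ σ₃))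

count-reflects : ∀ {k} (f : Fin k → ℕ) a (β : Fin k → Bool) →
  (∀ t → Reflects (f t ≡ a) (β t)) → count f a ≡ ∑ (bit ∘ β)
count-reflects {zero}  f a β r = refl
count-reflects {suc k} f a β r with f Fin.zero ≟ a | β Fin.zero | r Fin.zero
... | yes _  | true  | _       = cong suc (count-reflects (f ∘ Fin.suc) a (β ∘ Fin.suc) (r ∘ Fin.suc))
... | no _   | false | _       = count-reflects (f ∘ Fin.suc) a (β ∘ Fin.suc) (r ∘ Fin.suc)
... | yes p  | false | ofⁿ ¬p = contradiction p ¬p
... | no ¬p  | true  | ofʸ p  = contradiction p ¬p

level-low-reflects : ∀ n b → Reflects (level n b ≡ n) (not b)
level-low-reflects n false = ofʸ refl
level-low-reflects n true  = ofⁿ 1+n≢n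

level-high-reflects : ∀ n b → Reflects (level n b ≡ suc n) b
level-high-reflects n false = ofⁿ (1+n≢n ∘ sym)
level-high-reflects n true  = ofʸ refl

<ᵇ-true : ∀ {a b} → a < b → (a <ᵇ b) ≡ true
<ᵇ-true {a} {b} a<b with a <ᵇ b | <ᵇ-reflects-< a b
... | true  | _       = refl
... | false | ofⁿ a≮b = contradiction a<b a≮b

<ᵇ-false : ∀ {a b} → b ≤ a → (a <ᵇ b) ≡ false
<ᵇ-false {a} {b} b≤a with a <ᵇ b | <ᵇ-reflects-< a b
... | false | _       = refl
... | true  | ofʸ a<b = contradiction b≤a (<⇒≱ a<b)

highFrom : ℕ → ℕ → Bool
highFrom N T = not (T <ᵇ N)

Sorted : ∀ {K} → ℕ → ℕ → (Fin K → ℕ) → Set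
Sorted n N x = ∀ t → x t ≡ level n (highFrom N (toℕ t))

∑-below : ∀ {k N} → N ≤ k → ∑ {k} (λ t → bit (toℕ t <ᵇ N)) ≡ N
∑-below {k}     {zero}  z≤n       = ∑-zero k
∑-below {suc k} {suc N} (s≤s N≤k) = cong suc (∑-below N≤k)

∑-highFrom : ∀ k N → ∑ {k} (λ t → bit (highFrom N (toℕ t))) ≡ k ∸ N
∑-highFrom zero    N       = sym (0∸n≡0 N)
∑-highFrom (suc k) zero    = cong suc (∑-highFrom k zero)
∑-highFrom (suc k) (suc N) = ∑-highFrom k N

sorted-count-low : ∀ {K n N} {x : Fin K → ℕ} → Sorted n N x → N ≤ K → count x n ≡ N
sorted-count-low {K} {n} {N} {x} sorted N≤K = begin
  count x n                                     ≡⟨ count-reflects x n _ reflects ⟩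
  ∑ {K} (λ t → bit (not (highFrom N (toℕ t)))) ≡⟨ ∑-cong {K} (λ t → cong bit (not-involutive (toℕ t <ᵇ N))) ⟩
  ∑ {K} (λ t → bit (toℕ t <ᵇ N))               ≡⟨ ∑-below N≤K ⟩
  N                                             ∎
  where
  open ≡-Reasoning
  reflects : ∀ t → Reflects (x t ≡ n) (not (highFrom N (toℕ t)))
  reflects t = subst (λ v → Reflects (v ≡ n) _) (sym (sorted t)) (level-low-reflects n _)

sorted-count-high : ∀ {K n N} {x : Fin K → ℕ} → Sorted n N x → count x (suc n) ≡ K ∸ N
sorted-count-high {K} {n} {N} {x} sorted =
  trans (count-reflects x (suc n) _ reflects) (∑-highFrom K N)
  where
  reflects : ∀ t → Reflects (x t ≡ suc n) (highFrom N (toℕ t))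
  reflects t = subst (λ v → Reflects (v ≡ suc n) _) (sym (sorted t)) (level-high-reflects n _)

-- The middle block is constant, so it joins either the low or the high block.
shape-sorted : ∀ {m n} {x : Fin (m * m) → ℕ} → Shape m x n → Sorted n m x ⊎ Sorted n (m * (m ∸ 1)) x
shape-sorted {m} {n} {x} (c , n≤c , c≤1+n , low , middle , high) =
  Sum.map middle-high middle-low middle-value
  where
  A = m * (m ∸ 1)

  middle-value : c ≡ suc n ⊎ c ≡ n
  middle-value with m≤n⇒m<n∨m≡n n≤c
  ... | inj₁ n<c = inj₁ (≤-antisym c≤1+n n<c)
  ... | inj₂ n≡c = inj₂ (sym n≡c)

  middle-high : c ≡ suc n → Sorted n m x
  middle-high c≡1+n t with toℕ t <ᵇ m | <ᵇ-reflects-< (toℕ t) m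
  ... | true  | ofʸ t<m = low t t<m
  ... | false | ofⁿ t≮m with toℕ t <? A
  ...   | yes t<A = trans (middle t (≮⇒≥ t≮m) t<A) c≡1+n
  ...   | no  t≮A = high t (≮⇒≥ t≮A)

  middle-low : c ≡ n → Sorted n A x
  middle-low c≡n t with toℕ t <ᵇ A | <ᵇ-reflects-< (toℕ t) A
  ... | false | ofⁿ t≮A = high t (≮⇒≥ t≮A)
  ... | true  | ofʸ t<A with toℕ t <? m
  ...   | yes t<m = low t t<m
  ...   | no  t≮m = trans (middle t (≮⇒≥ t≮m) t<A) c≡n

other : Parity → Parity
other odd  = even
other even = odd

≢⇒other : ∀ {p q} → p ≢ q → q ≡ other p
≢⇒other {odd}  {odd}  p≢q = contradiction refl p≢q
≢⇒other {odd}  {even} _   = refl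
≢⇒other {even} {odd}  _   = refl
≢⇒other {even} {even} p≢q = contradiction refl p≢q

inWindow : ℕ → ℕ → ℕ → Bool
inWindow lo hi T = not (T <ᵇ lo) ∧ (T <ᵇ hi)

placedHigh : Parity → Bool → Bool
placedHigh odd  = not
placedHigh even b = b

sVal-placed : ∀ p n → sVal p n ≡ level n (placedHigh p true)
sVal-placed odd  n = refl
sVal-placed even n = refl

oVal-placed : ∀ p n → oVal p n ≡ level n (placedHigh p false)
oVal-placed odd  n = refl
oVal-placed even n = refl

places-reads : ∀ {K} {x : Fin K → ℕ} {h : Permutation′ K} {n} p lo hi →
  Places x h (sVal p n) (oVal p n) lo hi →
  ∀ t → x (h ⟨$⟩ʳ t) ≡ level n (placedHigh p (inWindow lo hi (toℕ t)))
places-reads {n = n} p lo hi places t with toℕ t <ᵇ lo | <ᵇ-reflects-< (toℕ t) lo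
... | true  | ofʸ t<lo = trans (proj₂ (places t) (inj₁ t<lo)) (oVal-placed p n)
... | false | ofⁿ t≮lo with toℕ t <ᵇ hi | <ᵇ-reflects-< (toℕ t) hi
...   | true  | ofʸ t<hi = trans (proj₁ (places t) (≮⇒≥ t≮lo) t<hi) (sVal-placed p n)
...   | false | ofⁿ t≮hi = trans (proj₂ (places t) (inj₂ (≮⇒≥ t≮hi))) (oVal-placed p n)

highFrom-reversed : ∀ {N H T} → T < N + H → highFrom N (N + H ∸ suc T) ≡ (T <ᵇ H)
highFrom-reversed {N} {H} {T} T<N+H with T <ᵇ H | <ᵇ-reflects-< T H
... | true  | ofʸ T<H = cong not (<ᵇ-false (m+n≤o⇒m≤o∸n N (+-monoʳ-≤ N T<H)))
... | false | ofⁿ T≮H = cong not (<ᵇ-true (subst (N + H ∸ suc T <_) (m+n∸n≡m N (suc T)) N+H∸1+T<N))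
  where
  N+H∸1+T<N : N + H ∸ suc T < N + suc T ∸ suc T
  N+H∸1+T<N = ∸-monoˡ-< (+-monoʳ-< N (s≤s (≮⇒≥ T≮H))) T<N+H

reversed-reads : ∀ {K n N H} {x : Fin K → ℕ} → Sorted n N x → N + H ≡ K →
  ∀ t → x (opposite t) ≡ level n (toℕ t <ᵇ H)
reversed-reads {K} {n} {N} {H} {x} sorted N+H≡K t = begin
  x (opposite t)                             ≡⟨ sorted (opposite t) ⟩
  level n (highFrom N (toℕ (opposite t)))    ≡⟨ cong (level n ∘ highFrom N) (opposite-prop t) ⟩
  level n (highFrom N (K ∸ suc (toℕ t)))     ≡⟨ cong (λ k → level n (highFrom N (k ∸ suc (toℕ t)))) N+H≡K ⟨
  level n (highFrom N (N + H ∸ suc (toℕ t))) ≡⟨ cong (level n) (highFrom-reversed {N} {H} t<N+H) ⟩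
  level n (toℕ t <ᵇ H)                       ∎
  where
  open ≡-Reasoning
  t<N+H : toℕ t < N + H
  t<N+H = subst (toℕ t <_) (sym N+H≡K) (toℕ<n t)

rotated-reads : ∀ {K n N} {x : Fin K → ℕ} M → Sorted n N x →
  ∀ t → x (gShift M t) ≡ level n (highFrom N (gℕ K M (toℕ t)))
rotated-reads {n = n} {N} M sorted t = trans (sorted (gShift M t)) (cong (level n ∘ highFrom N) (toℕ-fromℕ< _))

private
  square-split : ∀ j → 3 + j + (3 + j) * (2 + j) ≡ (3 + j) * (3 + j)
  square-split = solve-∀

  double-below : ∀ j → (3 + j) + (3 + j) + (3 + j) * j ≡ (3 + j) * (2 + j)
  double-below = solve-∀

m+m[m∸1]≡m*m : ∀ {m} → 3 ≤ m → m + m * (m ∸ 1) ≡ m * m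
m+m[m∸1]≡m*m (s≤s (s≤s (s≤s {n = j} z≤n))) = square-split j

m+m≤m[m∸1] : ∀ {m} → 3 ≤ m → m + m ≤ m * (m ∸ 1)
m+m≤m[m∸1] (s≤s (s≤s (s≤s {n = j} z≤n))) = subst (3 + j + (3 + j) ≤_) (double-below j) (m≤m+n _ ((3 + j) * j))

module Dimension (m : ℕ) (3≤m : 3 ≤ m) where

  K A : ℕ
  K = m * m
  A = m * (m ∸ 1)

  m+A≡K : m + A ≡ K
  m+A≡K = m+m[m∸1]≡m*m 3≤m

  m+m≤A : m + m ≤ A
  m+m≤A = m+m≤m[m∸1] 3≤m

  m≤A : m ≤ A
  m≤A = ≤-trans (m≤m+n m m) m+m≤A

  m<A : m < A
  m<A = <-≤-trans (m<m+n m (≤-trans (s≤s z≤n) 3≤m)) m+m≤A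

  lowCount highCount : Parity → ℕ
  lowCount odd  = m
  lowCount even = A
  highCount odd  = A
  highCount even = m

  lowCount+highCount : ∀ p → lowCount p + highCount p ≡ K
  lowCount+highCount odd  = m+A≡K
  lowCount+highCount even = trans (+-comm A m) m+A≡K

  lowCount≤K : ∀ p → lowCount p ≤ K
  lowCount≤K p = subst (lowCount p ≤_) (lowCount+highCount p) (m≤m+n (lowCount p) (highCount p))

  parity-sorted : ∀ {x n} p → Shape m x n → HasParity m x n p → Sorted n (lowCount p) x
  parity-sorted {x} {n} odd shape parity with shape-sorted shape
  ... | inj₁ sorted = sorted
  ... | inj₂ sorted = contradiction A≡m (>⇒≢ m<A)
    where
    A≡m : A ≡ m
    A≡m = trans (sym (sorted-count-low {N = A} sorted (lowCount≤K even))) parity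
  parity-sorted {x} {n} even shape parity with shape-sorted shape
  ... | inj₂ sorted = sorted
  ... | inj₁ sorted = contradiction A≡m (>⇒≢ m<A)
    where
    A≡m : A ≡ m
    A≡m = begin
      A                 ≡⟨ m+n∸m≡n m A ⟨
      m + A ∸ m         ≡⟨ cong (_∸ m) m+A≡K ⟩
      K ∸ m             ≡⟨ sorted-count-high {N = m} sorted ⟨
      count x (suc n)   ≡⟨ parity ⟩
      m                 ∎
      where open ≡-Reasoning

  rotated-below : ∀ p {T} → T < lowCount p → gℕ K (lowCount p) T ≡ highCount p + T
  rotated-below p {T} T<N = begin
    gℕ K N T          ≡⟨ gℕ-low K N T T<N ⟩
    K + T ∸ N         ≡⟨ cong (λ k → k + T ∸ N) (lowCount+highCount p) ⟨
    N + H + T ∸ N     ≡⟨ cong (_∸ N) (+-assoc N H T) ⟩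
    N + (H + T) ∸ N   ≡⟨ m+n∸m≡n N (H + T) ⟩
    H + T             ∎
    where
    open ≡-Reasoning
    N = lowCount p
    H = highCount p

  ∸-below : ∀ p {T} → lowCount p ≤ T → T < K → T ∸ lowCount p < highCount p
  ∸-below p {T} N≤T T<K = begin-strict
    T ∸ N      <⟨ ∸-monoˡ-< T<K N≤T ⟩
    K ∸ N      ≡⟨ cong (_∸ N) (lowCount+highCount p) ⟨
    N + H ∸ N  ≡⟨ m+n∸m≡n N H ⟩
    H          ∎
    where
    open ≤-Reasoning
    N = lowCount p
    H = highCount p

  rotatedHigh : Parity → ℕ → ℕ → Bool
  rotatedHigh p N T =
    if T <ᵇ lowCount p then highFrom N (highCount p + T) else highFrom N (T ∸ lowCount p)

  highFrom-rotated : ∀ p N T → highFrom N (gℕ K (lowCount p) T) ≡ rotatedHigh p N T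
  highFrom-rotated p N T = [ below , above ]′ (<-≤-connex T L)
    where
    L = lowCount p

    branch : Bool → Bool
    branch b = if b then highFrom N (highCount p + T) else highFrom N (T ∸ L)

    below : T < L → highFrom N (gℕ K L T) ≡ rotatedHigh p N T
    below T<L = trans (cong (highFrom N) (rotated-below p T<L)) (cong branch (sym (<ᵇ-true T<L)))

    above : L ≤ T → highFrom N (gℕ K L T) ≡ rotatedHigh p N T
    above L≤T = trans (cong (highFrom N) (gℕ-high K L T L≤T)) (cong branch (sym (<ᵇ-false L≤T)))

  Optimal : (x₁ x₂ x₃ : Fin K → ℕ) → ℕ → (h₁ h₂ h₃ : Permutation′ K) → Set
  Optimal x₁ x₂ x₃ n₁ h₁ h₂ h₃ =
    (arrangementSum x₁ x₂ x₃ h₁ h₂ h₃ ≡ ∑ (λ t → x₁ t * x₂ (opposite t) * x₃ (gShift (count x₁ n₁) t)))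
    × ((σ₁ σ₂ : Permutation′ K) →
       arrangementSum x₁ x₂ x₃ h₁ h₂ h₃ ≤ ∑ (λ t → x₁ t * x₂ (σ₁ ⟨$⟩ʳ t) * x₃ (σ₂ ⟨$⟩ʳ t)))

  Layout : (x₂ x₃ : Fin K → ℕ) (n₂ n₃ : ℕ) (p₁ p₂ p₃ : Parity) (h₂ h₃ : Permutation′ K) → Set
  Layout x₂ x₃ n₂ n₃ p₁ p₂ p₃ h₂ h₃ =
    (p₁ ≢ p₂ × p₁ ≢ p₃
      × Places x₂ h₂ (sVal p₂ n₂) (oVal p₂ n₂) 0 m
      × Places x₃ h₃ (sVal p₃ n₃) (oVal p₃ n₃) 0 m)
    ⊎ (p₁ ≢ p₂ × p₁ ≡ p₃
      × Places x₂ h₂ (sVal p₂ n₂) (oVal p₂ n₂) 0 m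
      × Places x₃ h₃ (sVal p₃ n₃) (oVal p₃ n₃) m (2 * m))
    ⊎ (p₁ ≡ p₂ × p₁ ≡ p₃
      × Places x₂ h₂ (sVal p₂ n₂) (oVal p₂ n₂) m (2 * m)
      × Places x₃ h₃ (sVal p₃ n₃) (oVal p₃ n₃) (2 * m) (3 * m))


  -- In placed-pqr and reference-pqr the parities of x₁, x₂, x₃ are p, q, r (o odd, e even),
  -- and the bits are those read at position T through (h₁, h₂, h₃) and through (id, f, g).
  placed-oee : ∀ T → Tight firstApart (not (T <ᵇ m)) (T <ᵇ m) (T <ᵇ m)
  placed-oee T with T <ᵇ m
  ... | true  = refl
  ... | false = refl

  reference-oee : ∀ T → T < K →
    Tight firstApart (highFrom m T) (T <ᵇ m) (rotatedHigh odd A T)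
  reference-oee T T<K with T <ᵇ m | <ᵇ-reflects-< T m
  ... | true  | ofʸ T<m rewrite <ᵇ-false (m≤m+n A T) = refl
  ... | false | ofⁿ T≮m rewrite <ᵇ-true (∸-below odd (≮⇒≥ T≮m) T<K) = refl

  placed-eoo : ∀ T → Tight firstApart (T <ᵇ m) (not (T <ᵇ m)) (not (T <ᵇ m))
  placed-eoo T with T <ᵇ m
  ... | true  = refl
  ... | false = refl

  reference-eoo : ∀ T → T < K →
    Tight firstApart (highFrom A T) (T <ᵇ A) (rotatedHigh even m T)
  reference-eoo T T<K with T <ᵇ A | <ᵇ-reflects-< T A
  ... | true  | ofʸ T<A rewrite <ᵇ-false (m≤m+n m T) = refl
  ... | false | ofⁿ T≮A rewrite <ᵇ-true (∸-below even (≮⇒≥ T≮A) T<K) = refl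

  placed-oeo : ∀ T → Tight firstThirdApart
    (not (T <ᵇ m)) (T <ᵇ m) (not (inWindow m (2 * m) T))
  placed-oeo T with T <ᵇ m | T <ᵇ 2 * m
  ... | true  | _     = refl
  ... | false | true  = refl
  ... | false | false = refl

  reference-oeo : ∀ T → T < K →
    Tight firstThirdApart (highFrom m T) (T <ᵇ m) (rotatedHigh odd m T)
  reference-oeo T T<K with T <ᵇ m | <ᵇ-reflects-< T m
  ... | true  | ofʸ T<m rewrite <ᵇ-false (≤-trans m≤A (m≤m+n A T)) = refl
  ... | false | ofⁿ T≮m with highFrom m (T ∸ m)
  ...   | true  = refl
  ...   | false = refl

  placed-eoe : ∀ T → Tight firstApart
    (T <ᵇ m) (not (T <ᵇ m)) (inWindow m (2 * m) T)
  placed-eoe T with T <ᵇ m | T <ᵇ 2 * m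
  ... | true  | _     = refl
  ... | false | true  = refl
  ... | false | false = refl

  reference-eoe : ∀ T → T < K →
    Tight firstApart (highFrom A T) (T <ᵇ A) (rotatedHigh even A T)
  reference-eoe T T<K with T <ᵇ A | <ᵇ-reflects-< T A
  ... | true  | ofʸ T<A with highFrom A (m + T)
  ...   | true  = refl
  ...   | false = refl
  reference-eoe T T<K | false | ofⁿ T≮A
    rewrite <ᵇ-true (<-≤-trans (∸-below even (≮⇒≥ T≮A) T<K) m≤A) = refl

  placed-ooo : ∀ T → Tight oneLow
    (not (T <ᵇ m)) (not (inWindow m (2 * m) T)) (not (inWindow (2 * m) (3 * m) T))
  placed-ooo T with T <ᵇ m | <ᵇ-reflects-< T m | T <ᵇ 2 * m | <ᵇ-reflects-< T (2 * m) | T <ᵇ 3 * m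
  ... | true  | ofʸ T<m | false | ofⁿ T≮2m | _ = contradiction (<-≤-trans T<m (m≤n*m m 2)) T≮2m
  ... | true  | _ | true  | _ | _     = refl
  ... | false | _ | true  | _ | _     = refl
  ... | false | _ | false | _ | true  = refl
  ... | false | _ | false | _ | false = refl

  reference-ooo : ∀ T → T < K →
    Tight oneLow (highFrom m T) (T <ᵇ A) (rotatedHigh odd m T)
  reference-ooo T T<K with T <ᵇ m | <ᵇ-reflects-< T m
  ... | true  | ofʸ T<m
    rewrite <ᵇ-true (<-≤-trans T<m m≤A) | <ᵇ-false (≤-trans m≤A (m≤m+n A T)) = refl
  ... | false | ofⁿ T≮m with T <ᵇ A | <ᵇ-reflects-< T A
  ...   | false | ofⁿ T≮A rewrite <ᵇ-false (m+n≤o⇒m≤o∸n m (≤-trans m+m≤A (≮⇒≥ T≮A))) = refl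
  ...   | true  | _ with highFrom m (T ∸ m)
  ...     | true  = refl
  ...     | false = refl

  placed-eee : ∀ T → Tight oneHigh
    (T <ᵇ m) (inWindow m (2 * m) T) (inWindow (2 * m) (3 * m) T)
  placed-eee T with T <ᵇ m | <ᵇ-reflects-< T m | T <ᵇ 2 * m | <ᵇ-reflects-< T (2 * m) | T <ᵇ 3 * m
  ... | true  | ofʸ T<m | false | ofⁿ T≮2m | _ = contradiction (<-≤-trans T<m (m≤n*m m 2)) T≮2m
  ... | true  | _ | true  | _ | _     = refl
  ... | false | _ | true  | _ | _     = refl
  ... | false | _ | false | _ | true  = refl
  ... | false | _ | false | _ | false = refl

  reference-eee : ∀ T → T < K →
    Tight oneHigh (highFrom A T) (T <ᵇ m) (rotatedHigh even A T)
  reference-eee T T<K with T <ᵇ A | <ᵇ-reflects-< T A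
  ... | false | ofⁿ T≮A
    rewrite <ᵇ-false (≤-trans m≤A (≮⇒≥ T≮A))
          | <ᵇ-true (<-≤-trans (∸-below even (≮⇒≥ T≮A) T<K) m≤A) = refl
  ... | true  | _ with T <ᵇ m | <ᵇ-reflects-< T m
  ...   | true  | ofʸ T<m rewrite <ᵇ-true (<-≤-trans (+-monoʳ-< m T<m) m+m≤A) = refl
  ...   | false | _ with highFrom A (m + T)
  ...     | true  = refl
  ...     | false = refl

  module _ {n₁ d₂ d₃ : ℕ} (x₁ x₂ x₃ : Fin K → ℕ) (h₁ h₂ h₃ : Permutation′ K) where

    optimal-if-tight : ∀ F p₁ p₂ p₃ lo₂ hi₂ lo₃ hi₃ →
      Sorted n₁ (lowCount p₁) x₁ → Sorted (n₁ + d₂) (lowCount p₂) x₂ → Sorted (n₁ + d₃) (lowCount p₃) x₃ →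
      Places x₁ h₁ (sVal p₁ n₁) (oVal p₁ n₁) 0 m →
      Places x₂ h₂ (sVal p₂ (n₁ + d₂)) (oVal p₂ (n₁ + d₂)) lo₂ hi₂ →
      Places x₃ h₃ (sVal p₃ (n₁ + d₃)) (oVal p₃ (n₁ + d₃)) lo₃ hi₃ →
      (∀ T → Tight F (placedHigh p₁ (T <ᵇ m)) (placedHigh p₂ (inWindow lo₂ hi₂ T))
                     (placedHigh p₃ (inWindow lo₃ hi₃ T))) →
      (∀ T → T < K → Tight F (highFrom (lowCount p₁) T) (T <ᵇ highCount p₂)
                                       (rotatedHigh p₁ (lowCount p₃) T)) →
      Optimal x₁ x₂ x₃ n₁ h₁ h₂ h₃
    optimal-if-tight F p₁ p₂ p₃ lo₂ hi₂ lo₃ hi₃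
                     S₁ S₂ S₃ P₁ P₂ P₃ placed-tight reference-tight =
        trans (proj₁ minimal) (cong (λ N → ∑ (λ t → x₁ t * x₂ (opposite t) * x₃ (gShift N t))) (sym count≡N₁))
      , λ σ₁ σ₂ → proj₂ minimal Perm.id σ₁ σ₂
      where
      open Minorant F n₁ d₂ d₃
      N₁ = lowCount p₁

      count≡N₁ : count x₁ n₁ ≡ N₁
      count≡N₁ = sorted-count-low {N = N₁} S₁ (lowCount≤K p₁)

      placed : TightArrangement x₁ x₂ x₃ h₁ h₂ h₃
      placed = record
        { β₁ = λ t → placedHigh p₁ (toℕ t <ᵇ m)
        ; β₂ = λ t → placedHigh p₂ (inWindow lo₂ hi₂ (toℕ t))
        ; β₃ = λ t → placedHigh p₃ (inWindow lo₃ hi₃ (toℕ t))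
        ; reads₁ = places-reads {x = x₁} {h₁} p₁ 0 m P₁
        ; reads₂ = places-reads {x = x₂} {h₂} p₂ lo₂ hi₂ P₂
        ; reads₃ = places-reads {x = x₃} {h₃} p₃ lo₃ hi₃ P₃
        ; tight = λ t → placed-tight (toℕ t)
        }

      reference : TightArrangement x₁ x₂ x₃ Perm.id Perm.reverse (rotation N₁ (lowCount≤K p₁))
      reference = record
        { β₁ = λ t → highFrom N₁ (toℕ t)
        ; β₂ = λ t → toℕ t <ᵇ highCount p₂
        ; β₃ = λ t → rotatedHigh p₁ (lowCount p₃) (toℕ t)
        ; reads₁ = S₁
        ; reads₂ = reversed-reads {N = lowCount p₂} S₂ (lowCount+highCount p₂)
        ; reads₃ = λ t → trans (rotated-reads {N = lowCount p₃} N₁ S₃ t)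
                               (cong (level (n₁ + d₃)) (highFrom-rotated p₁ (lowCount p₃) (toℕ t)))
        ; tight = λ t → reference-tight (toℕ t) (toℕ<n t)
        }

      minimal = tight-arrangements-minimal x₁ x₂ x₃ placed reference

    optimal : ∀ p₁ p₂ p₃ →
      Sorted n₁ (lowCount p₁) x₁ → Sorted (n₁ + d₂) (lowCount p₂) x₂ → Sorted (n₁ + d₃) (lowCount p₃) x₃ →
      Places x₁ h₁ (sVal p₁ n₁) (oVal p₁ n₁) 0 m →
      Layout x₂ x₃ (n₁ + d₂) (n₁ + d₃) p₁ p₂ p₃ h₂ h₃ →
      Optimal x₁ x₂ x₃ n₁ h₁ h₂ h₃
    optimal odd p₂ p₃ S₁ S₂ S₃ P₁ (inj₁ (≢p₂ , ≢p₃ , P₂ , P₃))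
      with refl ← ≢⇒other ≢p₂ | refl ← ≢⇒other ≢p₃ =
        optimal-if-tight firstApart odd even even 0 m 0 m S₁ S₂ S₃ P₁ P₂ P₃ placed-oee reference-oee
    optimal even p₂ p₃ S₁ S₂ S₃ P₁ (inj₁ (≢p₂ , ≢p₃ , P₂ , P₃))
      with refl ← ≢⇒other ≢p₂ | refl ← ≢⇒other ≢p₃ =
        optimal-if-tight firstApart even odd odd 0 m 0 m S₁ S₂ S₃ P₁ P₂ P₃ placed-eoo reference-eoo
    optimal odd p₂ _ S₁ S₂ S₃ P₁ (inj₂ (inj₁ (≢p₂ , refl , P₂ , P₃)))
      with refl ← ≢⇒other ≢p₂ =
        optimal-if-tight firstThirdApart odd even odd 0 m m (2 * m) S₁ S₂ S₃ P₁ P₂ P₃ placed-oeo reference-oeo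
    optimal even p₂ _ S₁ S₂ S₃ P₁ (inj₂ (inj₁ (≢p₂ , refl , P₂ , P₃)))
      with refl ← ≢⇒other ≢p₂ =
        optimal-if-tight firstApart even odd even 0 m m (2 * m) S₁ S₂ S₃ P₁ P₂ P₃ placed-eoe reference-eoe
    optimal odd _ _ S₁ S₂ S₃ P₁ (inj₂ (inj₂ (refl , refl , P₂ , P₃))) =
      optimal-if-tight oneLow odd odd odd m (2 * m) (2 * m) (3 * m) S₁ S₂ S₃ P₁ P₂ P₃ placed-ooo reference-ooo
    optimal even _ _ S₁ S₂ S₃ P₁ (inj₂ (inj₂ (refl , refl , P₂ , P₃))) =
      optimal-if-tight oneHigh even even even m (2 * m) (2 * m) (3 * m) S₁ S₂ S₃ P₁ P₂ P₃ placed-eee reference-eee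

mainTheorem8 :
    (m : ℕ) → 3 ≤ m →
    (x₁ x₂ x₃ : Fin (m * m) → ℕ) (n₁ n₂ n₃ : ℕ) →
    Shape m x₁ n₁ → Shape m x₂ n₂ → Shape m x₃ n₃ →
    n₁ ≤ n₂ → n₁ ≤ n₃ →
    (p₁ p₂ p₃ : Parity) →
    HasParity m x₁ n₁ p₁ → HasParity m x₂ n₂ p₂ → HasParity m x₃ n₃ p₃ →
    (h₁ h₂ h₃ : Permutation′ (m * m)) →
    Places x₁ h₁ (sVal p₁ n₁) (oVal p₁ n₁) 0 m →
    ((p₁ ≢ p₂ × p₁ ≢ p₃
        × Places x₂ h₂ (sVal p₂ n₂) (oVal p₂ n₂) 0 m
        × Places x₃ h₃ (sVal p₃ n₃) (oVal p₃ n₃) 0 m)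
     ⊎ (p₁ ≢ p₂ × p₁ ≡ p₃
        × Places x₂ h₂ (sVal p₂ n₂) (oVal p₂ n₂) 0 m
        × Places x₃ h₃ (sVal p₃ n₃) (oVal p₃ n₃) m (2 * m))
     ⊎ (p₁ ≡ p₂ × p₁ ≡ p₃
        × Places x₂ h₂ (sVal p₂ n₂) (oVal p₂ n₂) m (2 * m)
        × Places x₃ h₃ (sVal p₃ n₃) (oVal p₃ n₃) (2 * m) (3 * m))) →
    (∑ (λ t → x₁ (h₁ ⟨$⟩ʳ t) * x₂ (h₂ ⟨$⟩ʳ t) * x₃ (h₃ ⟨$⟩ʳ t))
       ≡ ∑ (λ t → x₁ t * x₂ (opposite t) * x₃ (gShift (count x₁ n₁) t)))
    × ((σ₁ σ₂ : Permutation′ (m * m)) →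
       ∑ (λ t → x₁ (h₁ ⟨$⟩ʳ t) * x₂ (h₂ ⟨$⟩ʳ t) * x₃ (h₃ ⟨$⟩ʳ t))
         ≤ ∑ (λ t → x₁ t * x₂ (σ₁ ⟨$⟩ʳ t) * x₃ (σ₂ ⟨$⟩ʳ t)))
mainTheorem8 m 3≤m x₁ x₂ x₃ n₁ n₂ n₃ shape₁ shape₂ shape₃ n₁≤n₂ n₁≤n₃ p₁ p₂ p₃ par₁ par₂ par₃
             h₁ h₂ h₃ P₁ layout
  with d₂ , refl ← m≤n⇒∃[o]m+o≡n n₁≤n₂ | d₃ , refl ← m≤n⇒∃[o]m+o≡n n₁≤n₃ =
    optimal x₁ x₂ x₃ h₁ h₂ h₃ p₁ p₂ p₃
      (parity-sorted p₁ shape₁ par₁) (parity-sorted p₂ shape₂ par₂) (parity-sorted p₃ shape₃ par₃) P₁ layout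
  where open Dimension m 3≤m
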